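{- If $T$ is a transmission irregular tree, then $T$ does not contain two distinct edges $e_1=xy$ and $e_2=uv$ with $|n_x-n_y|=|n_u-n_v|=1$.
   Context: For a graph $G$, the transmission of $v$ is ${\rm Tr}_G(v)=\sum_{u\in V(G)} d_G(u,v)$, where $d_G$ is the shortest-path distance. A graph is transmission irregular if all its vertices have pairwise different transmissions. For an edge $e=uv$, $n_u$ denotes the number of vertices strictly closer to $u$ than to $v$, and $n_v$ the number strictly closer to $v$ than to $u$. -}

module Defs where

open import Data.Nat using (ℕ; zero; suc; _≤_; _<_; _<?_; ∣_-_∣)
open import Data.Fin using (Fin)
open import Data.Bool using (Bool; true; false)
open import Data.List using (List; []; _∷_; length; filter; map; allFin; last)
open import Data.Nat.ListAction using (sum)
open import Data.Unit using (⊤)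
open import Data.List.Relation.Unary.Unique.Propositional using (Unique)
open import Data.Maybe using (just)
open import Data.Product using (Σ; _×_; _,_)
open import Data.Empty using (⊥)
open import Relation.Nullary using (¬_)
open import Relation.Binary.PropositionalEquality using (_≡_)

record Graph (n : ℕ) : Set where
  field
    adj   : Fin n → Fin n → Bool
    sym   : ∀ u v → adj u v ≡ adj v u
    irrfl : ∀ v → adj v v ≡ false

open Graph public

Adj : ∀ {n} → Graph n → Fin n → Fin n → Set
Adj G u v = adj G u v ≡ true

data Walk {n : ℕ} (G : Graph n) : Fin n → Fin n → ℕ → Set where
  here : ∀ {v} → Walk G v v zero
  step : ∀ {u w v k} → Adj G u w → Walk G w v k → Walk G u v (suc k)

Connected : ∀ {n} → Graph n → Set
Connected {n} G = ∀ (u v : Fin n) → Σ ℕ λ k → Walk G u v k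

Chain : ∀ {n} → Graph n → List (Fin n) → Set
Chain G []           = ⊤
Chain G (x ∷ [])     = ⊤
Chain G (x ∷ y ∷ xs) = Adj G x y × Chain G (y ∷ xs)

record Cycle {n : ℕ} (G : Graph n) : Set where
  field
    first  : Fin n
    rest   : List (Fin n)
    lst    : Fin n
    long   : 2 ≤ length rest
    dist   : Unique (first ∷ rest)
    chain  : Chain G (first ∷ rest)
    isLast : last (first ∷ rest) ≡ just lst
    closes : Adj G lst first

Acyclic : ∀ {n} → Graph n → Set
Acyclic G = ¬ Cycle G

IsTree : ∀ {n} → Graph n → Set
IsTree G = Connected G × Acyclic G

IsDistance : ∀ {n} → Graph n → (Fin n → Fin n → ℕ) → Set
IsDistance {n} G d =
  ∀ (u v : Fin n) → Walk G u v (d u v) × (∀ k → Walk G u v k → d u v ≤ k)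

Tr : ∀ {n} → (Fin n → Fin n → ℕ) → Fin n → ℕ
Tr {n} d v = sum (map (λ u → d u v) (allFin n))

TransmissionIrregular : ∀ {n} → (Fin n → Fin n → ℕ) → Set
TransmissionIrregular {n} d = ∀ (v w : Fin n) → Tr d v ≡ Tr d w → v ≡ w

-- n_x for the edge xy: number of vertices strictly closer to x than to y
nClose : ∀ {n} → (Fin n → Fin n → ℕ) → Fin n → Fin n → ℕ
nClose {n} d x y = length (filter (λ w → d w x <? d w y) (allFin n))

DistinctEdges : ∀ {n} → Fin n → Fin n → Fin n → Fin n → Set
DistinctEdges x y u v = ¬ (x ≡ u × y ≡ v) × ¬ (x ≡ v × y ≡ u)

module Submission where

-- For an edge ab call {w | d(w,a) < d(w,b)} the side of a; its size is n_a.
-- * Counting (module Counting): if every vertex lies on exactly one side and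
--   its distances to a and b differ by one, then n_a + n_b = n and
--   Tr(a) + n_a = Tr(b) + n_b.
-- * Acyclic graphs (modules Distances, Levels): two distinct vertices at the
--   same distance k from r are joined by a path within distance k of r, so
--   without cycles no two adjacent vertices are equidistant from r, and no
--   vertex has two neighbours closer to r than itself.
-- * Sides of tree edges (module Sides): hence the counting facts apply, the
--   only edge leaving the side of a is ab itself, and sides of different
--   edges nest.  Orienting two distinct edges so that the side of x lies in
--   the side of u and misses y gives n_x < n_u; if both edges are balanced,
--   arithmetic (balanced-split) forces n_u = n_y = n_x + 1 = n_v + 1.  Then y
--   is the only vertex of the side of u outside the side of x, so u = y, and
--   Tr(x) = Tr(v) follows; irregularity gives x = v, so the edges coincide.

open import Defs hiding (sym)
open import Data.Nat using (ℕ; zero; suc; _+_; _≤_; _<_; _<?_; ∣_-_∣; ⌊_/2⌋; z≤n; s≤s)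
open import Data.Nat.Properties
  using ( ≤-refl; ≤-trans; ≤-antisym; ≤-reflexive; <-cmp; <-irrefl; <-asym; <⇒≤; <⇒≱
        ; ≤-pred; n≢0⇒n>0; n≤1+n; n<1+n; m<n⇒m<1+n; m≤n⇒m≤1+n; 1+n≰n; 0≢1+n; suc-injective; +-suc; +-assoc
        ; +-cancelʳ-≡; ∣-∣-comm; n≡⌊n+n/2⌋ )
open import Data.Fin using (Fin; _≟_)
open import Data.List using (List; []; _∷_; _∷ʳ_; length; filter; map; allFin; last)
open import Data.List.Properties using (filter-accept; filter-reject; length-++-≤ʳ; length-tabulate)
open import Data.Nat.ListAction using (sum)
open import Data.List.Relation.Unary.All as All using (All; []; _∷_)
import Data.List.Relation.Unary.All.Properties as All
import Data.List.Relation.Unary.AllPairs.Properties as AllPairs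
open import Data.List.Relation.Unary.Unique.Propositional using (Unique; []; _∷_)
open import Data.List.Membership.Propositional using (_∈_)
open import Data.List.Membership.Propositional.Properties using (∈-allFin)
open import Data.List.Relation.Unary.Any using (here; there)
open import Data.Maybe using (just)
open import Data.Product using (Σ; _×_; _,_; proj₁; proj₂; ∃-syntax)
open import Data.Sum using (_⊎_; inj₁; inj₂; [_,_]′)
open import Data.Unit using (tt)
open import Data.Empty using (⊥; ⊥-elim)
open import Relation.Nullary using (¬_; Dec; yes; no)
open import Relation.Unary using (Decidable)
open import Relation.Binary.Definitions using (tri<; tri≈; tri>)
open import Relation.Binary.PropositionalEquality
  using (_≡_; _≢_; refl; sym; trans; cong; cong₂; subst; subst₂; ≢-sym; module ≡-Reasoning)

distance-one : ∀ m k → ∣ m - k ∣ ≡ 1 → m ≡ suc k ⊎ k ≡ suc m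
distance-one zero    (suc zero) _ = inj₂ refl
distance-one (suc zero) zero    _ = inj₁ refl
distance-one (suc m) (suc k) e with distance-one m k e
... | inj₁ m≡1+k = inj₁ (cong suc m≡1+k)
... | inj₂ k≡1+m = inj₂ (cong suc k≡1+m)

double-injective : ∀ m k → m + m ≡ k + k → m ≡ k
double-injective m k e = trans (n≡⌊n+n/2⌋ m) (trans (cong ⌊_/2⌋ e) (sym (n≡⌊n+n/2⌋ k)))

balanced-split : ∀ A B C D → A + B ≡ C + D → ∣ A - B ∣ ≡ 1 → ∣ C - D ∣ ≡ 1 → A < C
               → B ≡ C × C ≡ suc A × D ≡ A
balanced-split A B C D total ab cd A<C with distance-one A B ab | distance-one C D cd
... | inj₁ refl | inj₁ refl with double-injective B D (suc-injective total)
...   | refl = ⊥-elim (<-irrefl refl A<C)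
balanced-split A B C D total ab cd A<C | inj₁ refl | inj₂ refl
  with double-injective B C (suc-injective (trans total (+-suc C C)))
...   | refl = ⊥-elim (<-asym A<C (n<1+n _))
balanced-split A B C D total ab cd A<C | inj₂ refl | inj₁ refl
  with double-injective A D (suc-injective (trans (sym (+-suc A A)) total))
...   | refl = refl , refl , refl
balanced-split A B C D total ab cd A<C | inj₂ refl | inj₂ refl
  with double-injective A C (suc-injective (trans (sym (+-suc A A)) (trans total (+-suc C C))))
...   | refl = ⊥-elim (<-irrefl refl A<C)

module Counting {A : Set} where

  count : {P : A → Set} → Decidable P → List A → ℕ
  count P? L = length (filter P? L)

  module _ {P Q : A → Set} (P? : Decidable P) (Q? : Decidable Q)
           (cover : ∀ w → P w ⊎ Q w) (disjoint : ∀ {w} → P w → ¬ Q w) where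

    count-partition : ∀ L → count P? L + count Q? L ≡ length L
    count-partition [] = refl
    count-partition (w ∷ L) with cover w
    ... | inj₁ p rewrite filter-accept P? {xs = L} p | filter-reject Q? {xs = L} (disjoint p) =
      cong suc (count-partition L)
    ... | inj₂ q rewrite filter-reject P? {xs = L} (λ p → disjoint p q) | filter-accept Q? {xs = L} q =
      trans (+-suc _ _) (cong suc (count-partition L))

    sum-shift : (f g : A → ℕ) → (∀ {w} → P w → g w ≡ suc (f w)) → (∀ {w} → Q w → f w ≡ suc (g w))
              → ∀ L → sum (map g L) + count Q? L ≡ sum (map f L) + count P? L
    sum-shift f g onP onQ [] = refl
    sum-shift f g onP onQ (w ∷ L) with cover w
    ... | inj₁ p rewrite filter-accept P? {xs = L} p | filter-reject Q? {xs = L} (disjoint p) = begin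
      (g w + Σg) + #Q        ≡⟨ +-assoc (g w) Σg #Q ⟩
      g w + (Σg + #Q)        ≡⟨ cong₂ _+_ (onP p) (sum-shift f g onP onQ L) ⟩
      suc (f w) + (Σf + #P)  ≡⟨ sym (+-suc (f w) _) ⟩
      f w + (suc Σf + #P)    ≡⟨ cong (f w +_) (sym (+-suc Σf #P)) ⟩
      f w + (Σf + suc #P)    ≡⟨ sym (+-assoc (f w) Σf _) ⟩
      (f w + Σf) + suc #P    ∎
      where
        open ≡-Reasoning
        Σf = sum (map f L); Σg = sum (map g L); #P = count P? L; #Q = count Q? L
    ... | inj₂ q rewrite filter-reject P? {xs = L} (λ p → disjoint p q) | filter-accept Q? {xs = L} q = begin
      (g w + Σg) + suc #Q    ≡⟨ +-assoc (g w) Σg _ ⟩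
      g w + (Σg + suc #Q)    ≡⟨ cong (g w +_) (+-suc Σg #Q) ⟩
      g w + suc (Σg + #Q)    ≡⟨ +-suc (g w) _ ⟩
      suc (g w) + (Σg + #Q)  ≡⟨ cong₂ _+_ (sym (onQ q)) (sum-shift f g onP onQ L) ⟩
      f w + (Σf + #P)        ≡⟨ sym (+-assoc (f w) Σf #P) ⟩
      (f w + Σf) + #P        ∎
      where
        open ≡-Reasoning
        Σf = sum (map f L); Σg = sum (map g L); #P = count P? L; #Q = count Q? L

  module _ {P Q : A → Set} (P? : Decidable P) (Q? : Decidable Q) (P⊆Q : ∀ {w} → P w → Q w) where

    Extra : A → Set
    Extra w = Q w × ¬ P w

    excess-step : ∀ w L k → k + count P? L ≤ count Q? L → k + count P? (w ∷ L) ≤ count Q? (w ∷ L)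
    excess-step w L k h = by-cases (P? w) (Q? w)
      where
        by-cases : Dec (P w) → Dec (Q w) → k + count P? (w ∷ L) ≤ count Q? (w ∷ L)
        by-cases (yes p) _ rewrite filter-accept P? {xs = L} p | filter-accept Q? {xs = L} (P⊆Q p) =
          subst (_≤ suc (count Q? L)) (sym (+-suc k _)) (s≤s h)
        by-cases (no ¬p) (yes q) rewrite filter-reject P? {xs = L} ¬p | filter-accept Q? {xs = L} q =
          m≤n⇒m≤1+n h
        by-cases (no ¬p) (no ¬q) rewrite filter-reject P? {xs = L} ¬p | filter-reject Q? {xs = L} ¬q = h

    excess-extra : ∀ {w} L k → Extra w → k + count P? L ≤ count Q? L
                 → suc k + count P? (w ∷ L) ≤ count Q? (w ∷ L)
    excess-extra L k (q , ¬p) h rewrite filter-reject P? {xs = L} ¬p | filter-accept Q? {xs = L} q = s≤s h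

    count-mono : ∀ L → count P? L ≤ count Q? L
    count-mono [] = z≤n
    count-mono (w ∷ L) = excess-step w L 0 (count-mono L)

    count-gap : ∀ {t} L → t ∈ L → Extra t → suc (count P? L) ≤ count Q? L
    count-gap (w ∷ L) (here refl) x = excess-extra L 0 x (count-mono L)
    count-gap (w ∷ L) (there t∈L) x = excess-step w L 1 (count-gap L t∈L x)

    count-gap₂ : ∀ {t t′} L → t ∈ L → t′ ∈ L → t ≢ t′ → Extra t → Extra t′
               → 2 + count P? L ≤ count Q? L
    count-gap₂ (w ∷ L) (here refl)  (here refl)   t≢t′ x x′ = ⊥-elim (t≢t′ refl)
    count-gap₂ (w ∷ L) (here refl)  (there t′∈L)  t≢t′ x x′ = excess-extra L 1 x (count-gap L t′∈L x′)
    count-gap₂ (w ∷ L) (there t∈L) (here refl)    t≢t′ x x′ = excess-extra L 1 x′ (count-gap L t∈L x)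
    count-gap₂ (w ∷ L) (there t∈L) (there t′∈L)   t≢t′ x x′ = excess-step w L 2 (count-gap₂ L t∈L t′∈L t≢t′ x x′)

module Distances {n : ℕ} (G : Graph n) (d : Fin n → Fin n → ℕ) (isDistance : IsDistance G d) where

  private variable
    a b p q r u v w : Fin n
    j k : ℕ

  adj-sym : Adj G a b → Adj G b a
  adj-sym {a} {b} e = trans (Graph.sym G b a) e

  adj-irrefl : Adj G a b → a ≢ b
  adj-irrefl {a} e refl with trans (sym e) (irrfl G a)
  ... | ()

  walk-snoc : Walk G u v k → Adj G v w → Walk G u w (suc k)
  walk-snoc here       e = step e here
  walk-snoc (step e′ W) e = step e′ (walk-snoc W e)

  walk-reverse : Walk G u v k → Walk G v u k
  walk-reverse here       = here
  walk-reverse (step e W) = walk-snoc (walk-reverse W) (adj-sym e)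

  walk-empty : Walk G u v 0 → u ≡ v
  walk-empty here = refl

  shortest : ∀ u v → Walk G u v (d u v)
  shortest u v = proj₁ (isDistance u v)

  minimal : Walk G u v k → d u v ≤ k
  minimal {u} {v} W = proj₂ (isDistance u v) _ W

  d-sym : ∀ u v → d u v ≡ d v u
  d-sym u v = ≤-antisym (minimal (walk-reverse (shortest v u))) (minimal (walk-reverse (shortest u v)))

  d-self : ∀ v → d v v ≡ 0
  d-self v = ≤-antisym (minimal here) z≤n

  d-zero : d u v ≡ 0 → u ≡ v
  d-zero {u} {v} eq = walk-empty (subst (Walk G u v) eq (shortest u v))

  d-step : Adj G p q → d p r ≤ suc (d q r)
  d-step {r = r} e = minimal (step e (shortest _ r))

  d-step′ : Adj G a b → d w b ≤ suc (d w a)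
  d-step′ {w = w} e = minimal (walk-snoc (shortest w _) e)

  predecessor : d q r ≡ suc j → Σ (Fin n) λ p → Adj G q p × d p r ≡ j
  predecessor {q} {r} eq with subst (Walk G q r) eq (shortest q r)
  ... | step {w = p} e W = p , e , ≤-antisym (minimal W) (≤-pred (subst (_≤ suc (d p r)) eq (d-step e)))

module Levels {n : ℕ} (G : Graph n) (d : Fin n → Fin n → ℕ) (isDistance : IsDistance G d)
              (acyclic : Acyclic G) where

  open Distances G d isDistance

  private variable
    p q r s t s′ t′ u x y z : Fin n
    j k : ℕ

  record LowPath (r : Fin n) (k : ℕ) (s t : Fin n) : Set where
    field
      inner  : List (Fin n)
      unique : Unique (s ∷ inner)
      chain  : Chain G (s ∷ inner)
      ends   : last (s ∷ inner) ≡ just t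
      low    : All (λ w → d w r ≤ k) (s ∷ inner)
  open LowPath

  chain-snoc : ∀ xs → Chain G (s ∷ xs) → last (s ∷ xs) ≡ just t → Adj G t u → Chain G ((s ∷ xs) ∷ʳ u)
  chain-snoc []       _         refl e = e , tt
  chain-snoc (x ∷ xs) (e′ , ch) ends e = e′ , chain-snoc xs ch ends e

  last-snoc : ∀ (xs : List (Fin n)) → last ((s ∷ xs) ∷ʳ u) ≡ just u
  last-snoc []       = refl
  last-snoc (x ∷ xs) = last-snoc xs

  stay : d s r ≤ k → LowPath r k s s
  stay s≤k = record { inner = [] ; unique = [] ∷ [] ; chain = tt ; ends = refl ; low = s≤k ∷ [] }

  raise : j ≤ k → LowPath r j s t → LowPath r k s t
  raise j≤k P = record
    { inner = inner P ; unique = unique P ; chain = chain P ; ends = ends P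
    ; low = All.map (λ w≤j → ≤-trans w≤j j≤k) (low P) }

  avoids : (P : LowPath r k s t) → k < d q r → All (_≢ q) (s ∷ inner P)
  avoids {r = r} {k = k} P far = All.map (λ {w} w≤k w≡q → <⇒≱ far (subst (λ v → d v r ≤ k) w≡q w≤k)) (low P)

  prepend : Adj G q s → (P : LowPath r k s t) → All (_≢ q) (s ∷ inner P) → d q r ≤ k → LowPath r k q t
  prepend {s = s} e P fresh q≤k = record
    { inner  = s ∷ inner P
    ; unique = All.map ≢-sym fresh ∷ unique P
    ; chain  = e , chain P
    ; ends   = ends P
    ; low    = q≤k ∷ low P
    }

  append : (P : LowPath r k s t) → Adj G t u → All (_≢ u) (s ∷ inner P) → d u r ≤ k → LowPath r k s u
  append {u = u} P e fresh u≤k = record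
    { inner  = inner P ∷ʳ u
    ; unique = AllPairs.++⁺ (unique P) ([] ∷ []) (All.map (_∷ []) fresh)
    ; chain  = chain-snoc (inner P) (chain P) (ends P) e
    ; ends   = last-snoc (inner P)
    ; low    = All.∷ʳ⁺ (low P) u≤k
    }

  close : (P : LowPath r k s t) → 2 ≤ length (inner P) → Adj G t s → Cycle G
  close {s = s} {t = t} P long e = record
    { first = s ; rest = inner P ; lst = t ; long = long
    ; dist = unique P ; chain = chain P ; isLast = ends P ; closes = e }

  LongPath : Fin n → ℕ → Fin n → Fin n → Set
  LongPath r k s t = Σ (LowPath r k s t) λ P → 2 ≤ length (inner P)

  detour : LowPath r j s′ t′ → Adj G s s′ → Adj G t′ t → d s r ≡ suc j → d t r ≡ suc j → s ≢ t
         → LongPath r (suc j) s t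
  detour {j = j} P es et ds dt s≢t =
    prepend es P′ fresh (≤-reflexive ds) , s≤s (length-++-≤ʳ _ {inner P})
    where
      P′ = append (raise (n≤1+n j) P) et (avoids P (≤-reflexive (sym dt))) (≤-reflexive dt)
      fresh = All.∷ʳ⁺ (avoids P (≤-reflexive (sym ds))) (≢-sym s≢t)

  -- Any two vertices at distance k from r are joined by a path within distance
  -- k of r, with two or more inner vertices if they are distinct: walk both
  -- towards r until the walks meet.
  level-path : ∀ k → d s r ≡ k → d t r ≡ k → LowPath r k s t
  long-level-path : ∀ k → s ≢ t → d s r ≡ k → d t r ≡ k → LongPath r k s t

  level-path {s} {r} {t} k ds dt with s ≟ t
  ... | yes refl = stay (≤-reflexive ds)
  ... | no s≢t   = proj₁ (long-level-path k s≢t ds dt)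

  long-level-path zero s≢t ds dt = ⊥-elim (s≢t (trans (d-zero ds) (sym (d-zero dt))))
  long-level-path (suc j) s≢t ds dt with predecessor ds | predecessor dt
  ... | s′ , es , ds′ | t′ , et , dt′ = detour (level-path j ds′ dt′) es (adj-sym et) ds dt s≢t

  adjacent-levels-differ : Adj G x y → d x r ≢ d y r
  adjacent-levels-differ e eq with long-level-path _ (adj-irrefl e) refl (sym eq)
  ... | P , long = acyclic (close P long (adj-sym e))

  unique-closer-neighbour : Adj G q p → Adj G q z → d p r < d q r → d z r < d q r → p ≡ z
  unique-closer-neighbour {q} {p} {z} {r} ep ez p<q z<q with p ≟ z
  ... | yes p≡z = p≡z
  ... | no p≢z  with long-level-path _ p≢z refl (sym same-level)
    where
      one-below : ∀ {x} → Adj G q x → d x r < d q r → d q r ≡ suc (d x r)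
      one-below e x<q = ≤-antisym (d-step e) x<q
      same-level : d p r ≡ d z r
      same-level = suc-injective (trans (sym (one-below ep p<q)) (one-below ez z<q))
  ... | P , long = ⊥-elim (acyclic (close Q (m≤n⇒m≤1+n long) (adj-sym ez)))
    where
      Q = prepend ep (raise (<⇒≤ p<q) P) (avoids P p<q) ≤-refl

module Sides {n : ℕ} (G : Graph n) (d : Fin n → Fin n → ℕ) (isDistance : IsDistance G d)
             (acyclic : Acyclic G) where

  open Distances G d isDistance
  open Levels G d isDistance acyclic
  open Counting

  private variable
    a b p q u v w x y : Fin n

  Closer : Fin n → Fin n → Fin n → Set
  Closer w a b = d w a < d w b

  closer? : ∀ a b → Decidable (λ w → Closer w a b)
  closer? a b w = d w a <? d w b

  closer-or-closer : Adj G a b → ∀ w → Closer w a b ⊎ Closer w b a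
  closer-or-closer {a} {b} e w with <-cmp (d w a) (d w b)
  ... | tri< c _ _  = inj₁ c
  ... | tri≈ _ eq _ = ⊥-elim (adjacent-levels-differ e (trans (d-sym a w) (trans eq (d-sym w b))))
  ... | tri> _ _ c  = inj₂ c

  closer-by-one : Adj G a b → Closer w a b → d w b ≡ suc (d w a)
  closer-by-one e c = ≤-antisym (d-step′ e) c

  own-side : Adj G a b → Closer a a b
  own-side {a} {b} e = subst (_< d a b) (sym (d-self a)) (n≢0⇒n>0 (λ ab≡0 → adj-irrefl e (d-zero ab≡0)))

  side-sizes : Adj G a b → nClose d a b + nClose d b a ≡ n
  side-sizes {a} {b} e =
    trans (count-partition (closer? a b) (closer? b a) (closer-or-closer e) <-asym (allFin n))
          (length-tabulate (λ i → i))

  transmission-shift : Adj G a b → Tr d b + nClose d b a ≡ Tr d a + nClose d a b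
  transmission-shift {a} {b} e =
    sum-shift (closer? a b) (closer? b a) (closer-or-closer e) <-asym (λ w → d w a) (λ w → d w b)
              (closer-by-one e) (closer-by-one (adj-sym e)) (allFin n)

  -- The only edge from the side of a to the side of b is ab itself: otherwise
  -- q would have two neighbours closer to a, namely p and its neighbour towards b.
  crossing-edge : Adj G a b → Adj G p q → Closer p a b → Closer q b a → a ≡ p × b ≡ q
  crossing-edge {a} {b} {p} {q} eab epq p-a q-b = at-level (d p a) refl (sym same-level)
    where
      pb : d p b ≡ suc (d p a)
      pb = closer-by-one eab p-a
      qa : d q a ≡ suc (d q b)
      qa = closer-by-one (adj-sym eab) q-b
      same-level : d p a ≡ d q b
      same-level = ≤-antisym (≤-pred (subst (_≤ suc (d q b)) pb (d-step epq)))
                             (≤-pred (subst (_≤ suc (d p a)) qa (d-step (adj-sym epq))))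
      at-level : ∀ k → d p a ≡ k → d q b ≡ k → a ≡ p × b ≡ q
      at-level zero    pa qb = sym (d-zero pa) , sym (d-zero qb)
      at-level (suc m) pa qb with predecessor qb
      ... | z , ez , zb with unique-closer-neighbour (adj-sym epq) ez p<q z<q
        where
          q-level : d q a ≡ suc (suc m)
          q-level = trans qa (cong suc qb)
          p<q : d p a < d q a
          p<q = subst₂ _<_ (sym pa) (sym q-level) (n<1+n _)
          z<q : d z a < d q a
          z<q = subst (d z a <_) (sym q-level) (s≤s (subst (λ k → d z a ≤ suc k) zb (d-step′ (adj-sym eab))))
      ... | refl = ⊥-elim (<-irrefl (trans (sym zb) (trans pb (cong suc pa))) (m<n⇒m<1+n (n<1+n m)))

  side-closed : Adj G a b → Adj G p q → ¬ (a ≡ p × b ≡ q) → Closer p a b → Closer q a b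
  side-closed eab epq not-ab p-a with closer-or-closer eab _
  ... | inj₁ q-a = q-a
  ... | inj₂ q-b = ⊥-elim (not-ab (crossing-edge eab epq p-a q-b))

  side-nested : Adj G x y → Adj G u v → Closer v y x → Closer x u v → ∀ w → Closer w x y → Closer w u v
  side-nested {x} {y} {u} {v} exy euv v-y x-u w = by-level (d w x) w refl
    where
      by-level : ∀ k w → d w x ≡ k → Closer w x y → Closer w u v
      by-level zero w wx _ with d-zero wx
      ... | refl = x-u
      by-level (suc j) w wx w-x with predecessor wx
      ... | w′ , e , w′x =
        side-closed euv (adj-sym e) (λ { (_ , refl) → <-asym w-x v-y }) (by-level j w′ w′x w′-x)
        where
          w′-x : Closer w′ x y
          w′-x = side-closed exy e (λ { (refl , _) → 0≢1+n (trans (sym (d-self x)) wx) }) w-x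

  Balanced : Fin n → Fin n → Set
  Balanced a b = ∣ nClose d a b - nClose d b a ∣ ≡ 1

  balanced-flip : Balanced a b → Balanced b a
  balanced-flip {a} {b} = trans (∣-∣-comm (nClose d b a) (nClose d a b))

  TwoBalancedEdges : Fin n → Fin n → Fin n → Fin n → Set
  TwoBalancedEdges x y u v = Adj G x y × Adj G u v × DistinctEdges x y u v × Balanced x y × Balanced u v

  flip-first : TwoBalancedEdges x y u v → TwoBalancedEdges y x u v
  flip-first (exy , euv , (d₁ , d₂) , bxy , buv) =
    adj-sym exy , euv , ((λ (yu , xv) → d₂ (xv , yu)) , (λ (yv , xu) → d₁ (xu , yv))) ,
    balanced-flip bxy , buv

  flip-second : TwoBalancedEdges x y u v → TwoBalancedEdges x y v u
  flip-second (exy , euv , (d₁ , d₂) , bxy , buv) =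
    exy , adj-sym euv , (d₂ , d₁) , bxy , balanced-flip buv

  facing-edges : TransmissionIrregular d → TwoBalancedEdges x y u v
               → Closer u y x → Closer v y x → Closer x u v → ⊥
  facing-edges {x} {y} {u} {v} irregular (exy , euv , (d₁ , d₂) , bxy , buv) u-y v-y x-u =
    conclude (u ≟ y)
    where
      nx = nClose d x y; ny = nClose d y x; nu = nClose d u v; nv = nClose d v u

      nested : ∀ {w} → Closer w x y → Closer w u v
      nested = side-nested exy euv v-y x-u _

      y-u : Closer y u v
      y-u = side-closed euv exy (λ (ux , vy) → d₁ (sym ux , sym vy)) x-u

      y-not-x : ¬ Closer y x y
      y-not-x y-x = <-asym y-x (own-side (adj-sym exy))

      -- the side of u gains y over the side of x, which pins down all four sizes
      split : ny ≡ nu × nu ≡ suc nx × nv ≡ nx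
      split = balanced-split nx ny nu nv (trans (side-sizes exy) (sym (side-sizes euv))) bxy buv
                (count-gap (closer? x y) (closer? u v) nested (allFin n) (∈-allFin y) (y-u , y-not-x))

      same-transmission : u ≡ y → Tr d v ≡ Tr d x
      same-transmission u≡y with split
      ... | ny≡nu , _ , nv≡nx = +-cancelʳ-≡ _ _ _ (begin
        Tr d v + nx  ≡⟨ cong (Tr d v +_) (sym nv≡nx) ⟩
        Tr d v + nv  ≡⟨ transmission-shift euv ⟩
        Tr d u + nu  ≡⟨ cong₂ _+_ (cong (Tr d) u≡y) (sym ny≡nu) ⟩
        Tr d y + ny  ≡⟨ transmission-shift exy ⟩
        Tr d x + nx  ∎)
        where open ≡-Reasoning

      conclude : Dec (u ≡ y) → ⊥
      conclude (yes u≡y) = d₂ (sym (irregular v x (same-transmission u≡y)) , sym u≡y)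
      conclude (no u≢y)  = 1+n≰n (subst (2 + nx ≤_) (proj₁ (proj₂ split))
        (count-gap₂ (closer? x y) (closer? u v) nested (allFin n) (∈-allFin u) (∈-allFin y) u≢y
                    (own-side euv , λ u-x → <-asym u-x u-y) (y-u , y-not-x)))

  beyond-endpoint : TransmissionIrregular d → TwoBalancedEdges x y u v → Closer u y x → ⊥
  beyond-endpoint {x} {y} {u} {v} irregular edges@(exy , euv , (_ , d₂) , _) u-y =
    [ facing-edges irregular edges u-y v-y
    , facing-edges irregular (flip-second edges) v-y u-y
    ]′ (closer-or-closer euv x)
    where
      v-y : Closer v y x
      v-y = side-closed (adj-sym exy) euv (λ (yu , xv) → d₂ (xv , yu)) u-y

  no-two-balanced-edges : TransmissionIrregular d → TwoBalancedEdges x y u v → ⊥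
  no-two-balanced-edges {u = u} irregular edges@(exy , _) =
    [ beyond-endpoint irregular (flip-first edges) , beyond-endpoint irregular edges ]′ (closer-or-closer exy u)

proposition1p3 : ∀ {n : ℕ} (T : Graph n) (d : Fin n → Fin n → ℕ)
    → IsTree T → IsDistance T d → TransmissionIrregular d
    → ¬ (∃[ x ] ∃[ y ] ∃[ u ] ∃[ v ]
           (Adj T x y × Adj T u v × DistinctEdges x y u v
            × ∣ nClose d x y - nClose d y x ∣ ≡ 1
            × ∣ nClose d u v - nClose d v u ∣ ≡ 1))
proposition1p3 T d (_ , acyclic) isDistance irregular (x , y , u , v , edges) =
  Sides.no-two-balanced-edges T d isDistance acyclic irregular edges
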